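{- Let $U$ be an $(h,k)_q$-evasive subspace of $V=V(r,q^n)$. Then \[|U|\le\frac{(q^k-1)(q^{rn}-1)}{q^{hn}-1}+1.\]
   Context: $V(r,q^n)$ denotes an $r$-dimensional vector space over $\mathbb{F}_{q^n}$, viewed also as an $rn$-dimensional vector space over $\mathbb{F}_q$. For positive integers $h,k$, an $\mathbb{F}_q$-subspace $U$ of $V$ is $(h,k)_q$-evasive if $\langle U\rangle_{\mathbb{F}_{q^n}}$ has $\mathbb{F}_{q^n}$-dimension at least $h$ and every $h$-dimensional $\mathbb{F}_{q^n}$-subspace of $V$ meets $U$ in an $\mathbb{F}_q$-subspace of $\mathbb{F}_q$-dimension at most $k$. -}

module Defs where

open import Level using (0ℓ)
open import Data.Nat using (ℕ; zero; suc)
open import Data.List using (List; []; _∷_; length; filter; concatMap; map)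
open import Data.List.Membership.Propositional using (_∈_)
open import Data.List.Relation.Unary.Unique.Propositional using (Unique)
open import Data.Vec using (Vec; []; _∷_; replicate; zipWith)
import Data.Vec as V
open import Data.Vec.Relation.Unary.All using (All)
open import Data.Product using (Σ; ∃; _×_; _,_)
open import Relation.Nullary using (¬_; Dec)
open import Relation.Unary using (Pred; Decidable)
open import Relation.Binary.PropositionalEquality using (_≡_)
open import Algebra.Structures using (IsCommutativeRing)

record FiniteField : Set₁ where
  field
    Carrier : Set
    _+_ _*_ : Carrier → Carrier → Carrier
    -_      : Carrier → Carrier
    0# 1#   : Carrier
    isCommutativeRing : IsCommutativeRing _≡_ _+_ _*_ -_ 0# 1#
    0≢1     : ¬ (0# ≡ 1#)
    _⁻¹     : Carrier → Carrier
    inverse : ∀ x → ¬ (x ≡ 0#) → x * (x ⁻¹) ≡ 1#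
    _≟_     : (x y : Carrier) → Dec (x ≡ y)
    elements : List Carrier
    complete : ∀ x → x ∈ elements
    unique   : Unique elements

  order : ℕ
  order = length elements

record Subfield (L : FiniteField) : Set₁ where
  open FiniteField L hiding (order)
  field
    mem    : Pred Carrier 0ℓ
    mem?   : Decidable mem
    has0   : mem 0#
    has1   : mem 1#
    closed+ : ∀ {x y} → mem x → mem y → mem (x + y)
    closed* : ∀ {x y} → mem x → mem y → mem (x * y)
    closed- : ∀ {x} → mem x → mem (- x)
    closed⁻¹ : ∀ {x} → mem x → ¬ (x ≡ 0#) → mem (x ⁻¹)

  order : ℕ
  order = length (filter mem? elements)

module VectorSpace (L : FiniteField) (K : Subfield L) (r : ℕ) where
  open FiniteField L hiding (order)
  open Subfield K using (mem)

  Vect : Set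
  Vect = Vec Carrier r

  zeroV : Vect
  zeroV = replicate r 0#

  _+V_ : Vect → Vect → Vect
  _+V_ = zipWith _+_

  _·_ : Carrier → Vect → Vect
  c · v = V.map (c *_) v

  lincomb : ∀ {m} → Vec Carrier m → Vec Vect m → Vect
  lincomb [] [] = zeroV
  lincomb (c ∷ cs) (v ∷ vs) = (c · v) +V lincomb cs vs

  allVecs : (s : ℕ) → List (Vec Carrier s)
  allVecs zero = [] ∷ []
  allVecs (suc s) = concatMap (λ x → map (x ∷_) (allVecs s)) elements

  card : {U : Pred Vect 0ℓ} → Decidable U → ℕ
  card U? = length (filter U? (allVecs r))

  -- U is an F_q-subspace (F_q = K) of V
  record IsKSubspace (U : Pred Vect 0ℓ) : Set where
    field
      has0 : U zeroV
      closed+ : ∀ {u v} → U u → U v → U (u +V v)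
      closed· : ∀ {c u} → mem c → U u → U (c · u)

  LIndependent : ∀ {m} → Vec Vect m → Set
  LIndependent {m} vs = ∀ (cs : Vec Carrier m) → lincomb cs vs ≡ zeroV → All (_≡ 0#) cs

  InLSpan : ∀ {m} → Vec Vect m → Vect → Set
  InLSpan {m} vs x = Σ (Vec Carrier m) λ cs → lincomb cs vs ≡ x

  InKSpan : ∀ {m} → Vec Vect m → Vect → Set
  InKSpan {m} vs x = Σ (Vec Carrier m) λ cs → All mem cs × lincomb cs vs ≡ x

  -- dim_L ⟨U⟩_L ≥ h : U contains h L-linearly independent vectors
  LSpanDimAtLeast : Pred Vect 0ℓ → ℕ → Set
  LSpanDimAtLeast U h = Σ (Vec Vect h) λ us → All U us × LIndependent us

  -- dim_K S ≤ k : S is contained in the K-span of k vectors of S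
  KDimAtMost : Pred Vect 0ℓ → ℕ → Set
  KDimAtMost S k = Σ (Vec Vect k) λ ws → All S ws × (∀ {x} → S x → InKSpan ws x)

  -- (h,k)_q-evasive: ⟨U⟩ has L-dimension ≥ h, and for every h-dimensional
  -- L-subspace W = ⟨ws⟩_L (ws an L-basis), dim_K (U ∩ W) ≤ k.
  IsEvasive : Pred Vect 0ℓ → ℕ → ℕ → Set
  IsEvasive U h k =
    LSpanDimAtLeast U h ×
    (∀ (ws : Vec Vect h) → LIndependent ws →
       KDimAtMost (λ x → U x × InLSpan ws x) k)

module Submission where

-- The proof is an averaging argument.  Write Q = |L| and call a tuple
-- ws = (w₁, …, w_m) ordered-independent if each wᵢ lies outside the span of
-- the later ones.  Building these tuples one vector at a time yields
-- recurrences for their number G_m and for the total D_m of |U ∩ ⟨ws⟩| over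
-- them; the key fact is that for a ≢ 0 and t ∈ ⟨ws⟩ the affine bijection
-- w ↦ a·w + t maps L^r ∖ ⟨ws⟩ onto itself.  Solving the recurrences gives the
-- mean-value formula D_m (Q^r − 1) = G_m ((|U| − 1)(Q^m − 1) + Q^r − 1).  For
-- m = h evasiveness bounds each |U ∩ ⟨ws⟩| by q^k, so D_h ≤ q^k G_h, and
-- dividing by G_h > 0 gives the theorem.

open import Defs
open import Level using (0ℓ)
open import Data.Nat using (ℕ; zero; suc; _+_; _*_; _∸_; _^_; _≤_; _<_; z≤n; s≤s; >-nonZero)
open import Data.Nat.Properties hiding (_≟_)
open import Data.Nat.Tactic.RingSolver using (solve-∀)
open import Data.List using (List; []; _∷_; _++_; map; concatMap; length; filter; cartesianProductWith)
open import Data.List.Membership.Propositional using (_∈_; _∉_; lose)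
open import Data.List.Membership.Propositional.Properties using (∈-cartesianProductWith⁺)
open import Data.List.Relation.Unary.All using ([])
open import Data.List.Relation.Unary.AllPairs using ([]; _∷_)
open import Data.List.Relation.Unary.Any using (here; there; any?; satisfied)
open import Data.List.Relation.Unary.Unique.Propositional using (Unique)
open import Data.List.Relation.Unary.Unique.Propositional.Properties using (cartesianProductWith⁺; Unique[x∷xs]⇒x∉xs)
open import Data.Vec using (Vec; []; _∷_; replicate; zipWith)
import Data.Vec as Vec
open import Data.Vec.Properties using (∷-injective; ≡-dec; zipWith-assoc; zipWith-comm; zipWith-identityˡ; zipWith-identityʳ; zipWith-inverseˡ; zipWith-inverseʳ; map-replicate; map-∘; map-cong; map-id)
import Data.Vec.Relation.Unary.All as VecAll
open import Data.Product using (∃; _×_; _,_)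
open import Data.Unit using (⊤; tt)
open import Relation.Nullary using (¬_; Dec; yes; no; ¬?; contradiction; _×-dec_)
import Relation.Nullary.Decidable as Dec
open import Relation.Unary using (Pred; Decidable)
open import Relation.Binary.Definitions using (DecidableEquality)
open import Relation.Binary.PropositionalEquality
open import Algebra.Structures using (IsCommutativeRing; IsAbelianGroup)
open import Algebra.Bundles using (AbelianGroup)
import Algebra.Properties.Group as GroupProperties
import Algebra.Properties.CommutativeSemigroup as CommutativeSemigroupProperties
open CommutativeSemigroupProperties +-commutativeSemigroup using (interchange)
open CommutativeSemigroupProperties *-commutativeSemigroup using (x∙yz≈y∙xz)

∑ : {A : Set} → List A → (A → ℕ) → ℕ
∑ []       F = 0
∑ (x ∷ xs) F = F x + ∑ xs F

𝟙 : {P : Set} → Dec P → ℕ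
𝟙 (yes _) = 1
𝟙 (no _)  = 0

module _ {P : Set} where

  𝟙-yes : (d : Dec P) → P → 𝟙 d ≡ 1
  𝟙-yes (yes _) _ = refl
  𝟙-yes (no ¬p) p = contradiction p ¬p

  𝟙-no : (d : Dec P) → ¬ P → 𝟙 d ≡ 0
  𝟙-no (yes p) ¬p = contradiction p ¬p
  𝟙-no (no _)  _  = refl

  𝟙-compl : (d : Dec P) → 𝟙 d + 𝟙 (¬? d) ≡ 1
  𝟙-compl (yes _) = refl
  𝟙-compl (no _)  = refl

𝟙-× : {P Q : Set} (d : Dec P) (e : Dec Q) → 𝟙 (d ×-dec e) ≡ 𝟙 d * 𝟙 e
𝟙-× (yes _) (yes _) = refl
𝟙-× (yes _) (no _)  = refl
𝟙-× (no _)  _       = refl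

𝟙-cong : {P Q : Set} (d : Dec P) (e : Dec Q) → (P → Q) → (Q → P) → 𝟙 d ≡ 𝟙 e
𝟙-cong (yes p) e f g = sym (𝟙-yes e (f p))
𝟙-cong (no ¬p) e f g = sym (𝟙-no e (λ q → ¬p (g q)))

module _ {A : Set} where

  ∑-cong : ∀ xs {F G : A → ℕ} → (∀ x → F x ≡ G x) → ∑ xs F ≡ ∑ xs G
  ∑-cong []       e = refl
  ∑-cong (x ∷ xs) e = cong₂ _+_ (e x) (∑-cong xs e)

  ∑-mono : ∀ xs {F G : A → ℕ} → (∀ x → F x ≤ G x) → ∑ xs F ≤ ∑ xs G
  ∑-mono []       e = z≤n
  ∑-mono (x ∷ xs) e = +-mono-≤ (e x) (∑-mono xs e)

  ∑-+ : ∀ xs (F G : A → ℕ) → ∑ xs (λ x → F x + G x) ≡ ∑ xs F + ∑ xs G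
  ∑-+ []       F G = refl
  ∑-+ (x ∷ xs) F G =
    trans (cong (F x + G x +_) (∑-+ xs F G)) (interchange (F x) (G x) (∑ xs F) (∑ xs G))

  ∑-*ˡ : ∀ xs (a : ℕ) (F : A → ℕ) → ∑ xs (λ x → a * F x) ≡ a * ∑ xs F
  ∑-*ˡ []       a F = sym (*-zeroʳ a)
  ∑-*ˡ (x ∷ xs) a F =
    trans (cong (a * F x +_) (∑-*ˡ xs a F)) (sym (*-distribˡ-+ a (F x) (∑ xs F)))

  ∑-*ʳ : ∀ xs (F : A → ℕ) (a : ℕ) → ∑ xs (λ x → F x * a) ≡ ∑ xs F * a
  ∑-*ʳ xs F a =
    trans (∑-cong xs (λ x → *-comm (F x) a)) (trans (∑-*ˡ xs a F) (*-comm a (∑ xs F)))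

  ∑-zero : ∀ xs → ∑ xs (λ (_ : A) → 0) ≡ 0
  ∑-zero []       = refl
  ∑-zero (x ∷ xs) = ∑-zero xs

  ∑-length : ∀ xs → ∑ xs (λ (_ : A) → 1) ≡ length xs
  ∑-length []       = refl
  ∑-length (x ∷ xs) = cong suc (∑-length xs)

  ∑-++ : ∀ xs ys (F : A → ℕ) → ∑ (xs ++ ys) F ≡ ∑ xs F + ∑ ys F
  ∑-++ []       ys F = refl
  ∑-++ (x ∷ xs) ys F = trans (cong (F x +_) (∑-++ xs ys F)) (sym (+-assoc (F x) _ _))

  ∑-≥ : ∀ {x xs} (F : A → ℕ) → x ∈ xs → F x ≤ ∑ xs F
  ∑-≥ F (here refl)                 = m≤m+n _ _
  ∑-≥ {xs = y ∷ _} F (there x∈xs) = ≤-trans (∑-≥ F x∈xs) (m≤n+m _ (F y))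

  length-filter : ∀ {P : Pred A _} (P? : Decidable P) xs →
                  length (filter P? xs) ≡ ∑ xs (λ x → 𝟙 (P? x))
  length-filter P? []       = refl
  length-filter P? (x ∷ xs) with P? x
  ... | yes _ = cong suc (length-filter P? xs)
  ... | no  _ = length-filter P? xs

module _ {A B : Set} where

  ∑-map : ∀ xs (f : A → B) (F : B → ℕ) → ∑ (map f xs) F ≡ ∑ xs (λ x → F (f x))
  ∑-map []       f F = refl
  ∑-map (x ∷ xs) f F = cong (F (f x) +_) (∑-map xs f F)

  ∑-swap : ∀ xs ys (F : A → B → ℕ) →
           ∑ xs (λ x → ∑ ys (λ y → F x y)) ≡ ∑ ys (λ y → ∑ xs (λ x → F x y))
  ∑-swap []       ys F = sym (∑-zero ys)
  ∑-swap (x ∷ xs) ys F =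
    trans (cong (∑ ys (F x) +_) (∑-swap xs ys F)) (sym (∑-+ ys (F x) (λ y → ∑ xs (λ x → F x y))))

module _ {A B C : Set} where

  ∑-cartesianProductWith : ∀ (f : A → B → C) xs ys (F : C → ℕ) →
    ∑ (cartesianProductWith f xs ys) F ≡ ∑ xs (λ x → ∑ ys (λ y → F (f x y)))
  ∑-cartesianProductWith f []       ys F = refl
  ∑-cartesianProductWith f (x ∷ xs) ys F = begin
    ∑ (map (f x) ys ++ cartesianProductWith f xs ys) F
      ≡⟨ ∑-++ (map (f x) ys) _ F ⟩
    ∑ (map (f x) ys) F + ∑ (cartesianProductWith f xs ys) F
      ≡⟨ cong₂ _+_ (∑-map ys (f x) F) (∑-cartesianProductWith f xs ys F) ⟩
    ∑ ys (λ y → F (f x y)) + ∑ xs (λ x → ∑ ys (λ y → F (f x y))) ∎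
    where open ≡-Reasoning

record Enumeration (A : Set) : Set where
  field
    list     : List A
    complete : ∀ x → x ∈ list
    unique   : Unique list
    _≟_      : DecidableEquality A

module Summation {A : Set} (E : Enumeration A) where
  open Enumeration E

  ∑-onePoint : ∀ a (F : A → ℕ) → ∑ list (λ x → 𝟙 (x ≟ a) * F x) ≡ F a
  ∑-onePoint a F = go list unique (complete a)
    where
    absent : ∀ xs → a ∉ xs → ∑ xs (λ x → 𝟙 (x ≟ a) * F x) ≡ 0
    absent []       a∉xs = refl
    absent (x ∷ xs) a∉xs with x ≟ a
    ... | yes refl = contradiction (here refl) a∉xs
    ... | no  _    = absent xs (λ a∈xs → a∉xs (there a∈xs))
    go : ∀ xs → Unique xs → a ∈ xs → ∑ xs (λ x → 𝟙 (x ≟ a) * F x) ≡ F a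
    go (x ∷ xs) u@(_ ∷ u′) (there a∈xs) with x ≟ a
    ... | yes refl = contradiction a∈xs (Unique[x∷xs]⇒x∉xs u)
    ... | no  _    = go xs u′ a∈xs
    go (x ∷ xs) u (here refl) with x ≟ x
    ... | no x≢x = contradiction refl x≢x
    ... | yes _  = begin
      F x + 0 + ∑ xs (λ y → 𝟙 (y ≟ x) * F y) ≡⟨ cong₂ _+_ (+-identityʳ (F x)) (absent xs (Unique[x∷xs]⇒x∉xs u)) ⟩
      F x + 0                                 ≡⟨ +-identityʳ (F x) ⟩
      F x                                     ∎
      where open ≡-Reasoning

  ∑-singleton : ∀ a → ∑ list (λ x → 𝟙 (x ≟ a)) ≡ 1
  ∑-singleton a = trans (∑-cong list (λ x → sym (*-identityʳ (𝟙 (x ≟ a))))) (∑-onePoint a (λ _ → 1))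

  ∑-split : ∀ a (F : A → ℕ) → ∑ list F ≡ F a + ∑ list (λ x → 𝟙 (¬? (x ≟ a)) * F x)
  ∑-split a F = begin
    ∑ list F
      ≡⟨ ∑-cong list (λ x → sym (trans (sym (*-distribʳ-+ (F x) (𝟙 (x ≟ a)) _))
                                        (trans (cong (_* F x) (𝟙-compl (x ≟ a))) (*-identityˡ (F x))))) ⟩
    ∑ list (λ x → 𝟙 (x ≟ a) * F x + 𝟙 (¬? (x ≟ a)) * F x)
      ≡⟨ ∑-+ list _ _ ⟩
    ∑ list (λ x → 𝟙 (x ≟ a) * F x) + ∑ list (λ x → 𝟙 (¬? (x ≟ a)) * F x)
      ≡⟨ cong (_+ ∑ list (λ x → 𝟙 (¬? (x ≟ a)) * F x)) (∑-onePoint a F) ⟩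
    F a + ∑ list (λ x → 𝟙 (¬? (x ≟ a)) * F x) ∎
    where open ≡-Reasoning

module Reindexing {A B : Set} (EA : Enumeration A) (EB : Enumeration B) where
  private
    module EA = Enumeration EA
    module EB = Enumeration EB
    module SA = Summation EA
    module SB = Summation EB
  open EA using (_≟_)

  ∑-image : (f : B → A) → (∀ {d e} → f d ≡ f e → d ≡ e) →
            {P : A → Set} (P? : ∀ x → Dec (P x)) →
            (∀ {x} → P x → ∃ λ d → f d ≡ x) → (∀ d → P (f d)) →
            (H : A → ℕ) → ∑ EA.list (λ x → 𝟙 (P? x) * H x) ≡ ∑ EB.list (λ d → H (f d))
  ∑-image f f-inj {P} P? image image⁻ H = sym (begin
    ∑ EB.list (λ d → H (f d))
      ≡⟨ ∑-cong EB.list (λ d → sym (SA.∑-onePoint (f d) H)) ⟩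
    ∑ EB.list (λ d → ∑ EA.list (λ x → 𝟙 (x ≟ f d) * H x))
      ≡⟨ ∑-swap EB.list EA.list _ ⟩
    ∑ EA.list (λ x → ∑ EB.list (λ d → 𝟙 (x ≟ f d) * H x))
      ≡⟨ ∑-cong EA.list (λ x → ∑-*ʳ EB.list (λ d → 𝟙 (x ≟ f d)) (H x)) ⟩
    ∑ EA.list (λ x → ∑ EB.list (λ d → 𝟙 (x ≟ f d)) * H x)
      ≡⟨ ∑-cong EA.list (λ x → cong (_* H x) (fibre x)) ⟩
    ∑ EA.list (λ x → 𝟙 (P? x) * H x) ∎)
    where
    open ≡-Reasoning
    fibre : ∀ x → ∑ EB.list (λ d → 𝟙 (x ≟ f d)) ≡ 𝟙 (P? x)
    fibre x with P? x
    ... | no ¬p = trans (∑-cong EB.list (λ d → 𝟙-no (x ≟ f d) (λ { refl → ¬p (image⁻ d) })))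
                        (∑-zero EB.list)
    ... | yes p with image p
    ...   | d₀ , refl = trans (∑-cong EB.list (λ d → 𝟙-cong (f d₀ ≟ f d) (d EB.≟ d₀)
                                                     (λ e → f-inj (sym e)) (λ e → cong f (sym e))))
                              (SB.∑-singleton d₀)

  count-cover : (f : B → A) {P : A → Set} {Q : B → Set}
                (P? : ∀ x → Dec (P x)) (Q? : ∀ d → Dec (Q d)) →
                (∀ {x} → P x → ∃ λ d → Q d × f d ≡ x) →
                ∑ EA.list (λ x → 𝟙 (P? x)) ≤ ∑ EB.list (λ d → 𝟙 (Q? d))
  count-cover f P? Q? cover = begin
    ∑ EA.list (λ x → 𝟙 (P? x))
      ≤⟨ ∑-mono EA.list covered ⟩
    ∑ EA.list (λ x → ∑ EB.list (λ d → 𝟙 (Q? d) * 𝟙 (x ≟ f d)))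
      ≡⟨ ∑-swap EA.list EB.list _ ⟩
    ∑ EB.list (λ d → ∑ EA.list (λ x → 𝟙 (Q? d) * 𝟙 (x ≟ f d)))
      ≡⟨ ∑-cong EB.list (λ d → trans (∑-*ˡ EA.list (𝟙 (Q? d)) _)
                                      (trans (cong (𝟙 (Q? d) *_) (SA.∑-singleton (f d))) (*-identityʳ _))) ⟩
    ∑ EB.list (λ d → 𝟙 (Q? d)) ∎
    where
    open ≤-Reasoning
    covered : ∀ x → 𝟙 (P? x) ≤ ∑ EB.list (λ d → 𝟙 (Q? d) * 𝟙 (x ≟ f d))
    covered x with P? x
    ... | no _  = z≤n
    ... | yes p with cover p
    ...   | d , q , refl = ≤-trans (≤-reflexive (sym (cong₂ _*_ (𝟙-yes (Q? d) q) (𝟙-yes (f d ≟ f d) refl))))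
                                   (∑-≥ (λ d′ → 𝟙 (Q? d′) * 𝟙 (f d ≟ f d′)) (EB.complete d))

module _ {A : Set} (E : Enumeration A) where
  open Enumeration E
  open Reindexing E E

  ∑-bijection : (g h : A → A) → (∀ x → h (g x) ≡ x) → (∀ y → g (h y) ≡ y) →
                (H : A → ℕ) → ∑ list (λ x → H (g x)) ≡ ∑ list H
  ∑-bijection g h hg gh H = sym (trans
    (∑-cong list (λ x → sym (*-identityˡ (H x))))
    (∑-image g (λ {d e} e′ → trans (sym (hg d)) (trans (cong h e′) (hg e)))
             (λ _ → yes tt) (λ {y} _ → h y , gh y) (λ _ → tt) H))

concatMap-map≡cartesianProductWith : {A B C : Set} (f : A → B → C) (xs : List A) (ys : List B) →
  concatMap (λ x → map (f x) ys) xs ≡ cartesianProductWith f xs ys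
concatMap-map≡cartesianProductWith f []       ys = refl
concatMap-map≡cartesianProductWith f (x ∷ xs) ys =
  cong (map (f x) ys ++_) (concatMap-map≡cartesianProductWith f xs ys)

vectors : {A : Set} → List A → (s : ℕ) → List (Vec A s)
vectors xs zero    = [] ∷ []
vectors xs (suc s) = cartesianProductWith _∷_ xs (vectors xs s)

vectorEnumeration : {A : Set} → Enumeration A → (s : ℕ) → Enumeration (Vec A s)
vectorEnumeration {A} E s = record
  { list = vectors list s ; complete = complete′ s ; unique = unique′ s ; _≟_ = ≡-dec _≟_ }
  where
  open Enumeration E
  complete′ : ∀ s (v : Vec A s) → v ∈ vectors list s
  complete′ zero    []      = here refl
  complete′ (suc s) (a ∷ v) = ∈-cartesianProductWith⁺ _∷_ (complete a) (complete′ s v)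
  unique′ : ∀ s → Unique (vectors list s)
  unique′ zero    = [] ∷ []
  unique′ (suc s) = cartesianProductWith⁺ _∷_ ∷-injective unique (unique′ s)

module _ {A : Set} (xs : List A) where

  count-vectors : ∀ s → ∑ (vectors xs s) (λ _ → 1) ≡ length xs ^ s
  count-vectors zero    = refl
  count-vectors (suc s) = begin
    ∑ (cartesianProductWith _∷_ xs (vectors xs s)) (λ _ → 1)
      ≡⟨ ∑-cartesianProductWith _∷_ xs (vectors xs s) (λ _ → 1) ⟩
    ∑ xs (λ _ → ∑ (vectors xs s) (λ _ → 1))
      ≡⟨ ∑-cong xs (λ _ → trans (count-vectors s) (sym (*-identityˡ _))) ⟩
    ∑ xs (λ _ → 1 * length xs ^ s)
      ≡⟨ ∑-*ʳ xs (λ _ → 1) (length xs ^ s) ⟩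
    ∑ xs (λ _ → 1) * length xs ^ s
      ≡⟨ cong (_* length xs ^ s) (∑-length xs) ⟩
    length xs * length xs ^ s ∎
    where open ≡-Reasoning

  count-vectors-All : {P : A → Set} (P? : Decidable P) →
    ∀ s → ∑ (vectors xs s) (λ v → 𝟙 (VecAll.all? P? v)) ≡ ∑ xs (λ x → 𝟙 (P? x)) ^ s
  count-vectors-All P? zero    = refl
  count-vectors-All P? (suc s) = begin
    ∑ (cartesianProductWith _∷_ xs (vectors xs s)) (λ v → 𝟙 (VecAll.all? P? v))
      ≡⟨ ∑-cartesianProductWith _∷_ xs (vectors xs s) _ ⟩
    ∑ xs (λ a → ∑ (vectors xs s) (λ v → 𝟙 (VecAll.all? P? (a ∷ v))))
      ≡⟨ ∑-cong xs (λ a → trans (∑-cong (vectors xs s) (𝟙-all?-∷ a))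
                                 (∑-*ˡ (vectors xs s) (𝟙 (P? a)) _)) ⟩
    ∑ xs (λ a → 𝟙 (P? a) * ∑ (vectors xs s) (λ v → 𝟙 (VecAll.all? P? v)))
      ≡⟨ ∑-*ʳ xs (λ a → 𝟙 (P? a)) _ ⟩
    ∑ xs (λ a → 𝟙 (P? a)) * ∑ (vectors xs s) (λ v → 𝟙 (VecAll.all? P? v))
      ≡⟨ cong (∑ xs (λ a → 𝟙 (P? a)) *_) (count-vectors-All P? s) ⟩
    ∑ xs (λ a → 𝟙 (P? a)) * ∑ xs (λ a → 𝟙 (P? a)) ^ s ∎
    where
    open ≡-Reasoning
    𝟙-all?-∷ : ∀ {s} a (v : Vec A s) → 𝟙 (VecAll.all? P? (a ∷ v)) ≡ 𝟙 (P? a) * 𝟙 (VecAll.all? P? v)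
    𝟙-all?-∷ a v with P? a | VecAll.all? P? v
    ... | yes _ | yes _ = refl
    ... | yes _ | no  _ = refl
    ... | no  _ | _     = refl

module Coordinates (L : FiniteField) where
  open FiniteField L renaming (_+_ to _⊕_; _*_ to _⊗_; -_ to ⊖_) hiding (order)
  private module F = IsCommutativeRing isCommutativeRing

  fieldEnumeration : Enumeration Carrier
  fieldEnumeration = record { list = elements ; complete = complete ; unique = unique ; _≟_ = _≟_ }

  vecEnumeration : ∀ s → Enumeration (Vec Carrier s)
  vecEnumeration = vectorEnumeration fieldEnumeration

  _≟ᵥ_ : ∀ {s} (u v : Vec Carrier s) → Dec (u ≡ v)
  _≟ᵥ_ {s} = Enumeration._≟_ (vecEnumeration s)

  -- the coordinatewise operations; at length r they are those of VectorSpace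
  infixl 6 _+ᵥ_
  infixr 7 _·ᵥ_

  _+ᵥ_ : ∀ {s} → Vec Carrier s → Vec Carrier s → Vec Carrier s
  _+ᵥ_ = zipWith _⊕_

  0ᵥ : ∀ {s} → Vec Carrier s
  0ᵥ = replicate _ 0#

  -ᵥ_ : ∀ {s} → Vec Carrier s → Vec Carrier s
  -ᵥ_ = Vec.map ⊖_

  _·ᵥ_ : ∀ {s} → Carrier → Vec Carrier s → Vec Carrier s
  a ·ᵥ v = Vec.map (a ⊗_) v

  +ᵥ-abelianGroup : ℕ → AbelianGroup 0ℓ 0ℓ
  +ᵥ-abelianGroup s = record { isAbelianGroup = isAbelianGroup }
    where
    isAbelianGroup : IsAbelianGroup _≡_ (_+ᵥ_ {s}) 0ᵥ -ᵥ_
    isAbelianGroup = record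
      { isGroup = record
        { isMonoid = record
          { isSemigroup = record { isMagma = isMagma _+ᵥ_ ; assoc = zipWith-assoc F.+-assoc }
          ; identity    = zipWith-identityˡ F.+-identityˡ , zipWith-identityʳ F.+-identityʳ }
        ; inverse = zipWith-inverseˡ F.-‿inverseˡ , zipWith-inverseʳ F.-‿inverseʳ
        ; ⁻¹-cong = cong -ᵥ_ }
      ; comm = zipWith-comm F.+-comm }

  module VecGroup (s : ℕ) where
    open AbelianGroup (+ᵥ-abelianGroup s) public
      using (identityˡ; inverseˡ; inverseʳ; group; commutativeSemigroup)
    open GroupProperties group public
    open CommutativeSemigroupProperties commutativeSemigroup public using (interchange)

  ·ᵥ-distribˡ : ∀ {s} a (u v : Vec Carrier s) → a ·ᵥ (u +ᵥ v) ≡ a ·ᵥ u +ᵥ a ·ᵥ v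
  ·ᵥ-distribˡ a []       []       = refl
  ·ᵥ-distribˡ a (x ∷ u) (y ∷ v) = cong₂ _∷_ (F.distribˡ a x y) (·ᵥ-distribˡ a u v)

  ·ᵥ-distribʳ : ∀ {s} a b (v : Vec Carrier s) → (a ⊕ b) ·ᵥ v ≡ a ·ᵥ v +ᵥ b ·ᵥ v
  ·ᵥ-distribʳ a b []      = refl
  ·ᵥ-distribʳ a b (x ∷ v) = cong₂ _∷_ (F.distribʳ x a b) (·ᵥ-distribʳ a b v)

  ·ᵥ-assoc : ∀ {s} a b (v : Vec Carrier s) → (a ⊗ b) ·ᵥ v ≡ a ·ᵥ (b ·ᵥ v)
  ·ᵥ-assoc a b v = trans (map-cong (F.*-assoc a b) v) (map-∘ (a ⊗_) (b ⊗_) v)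

  ·ᵥ-zeroˡ : ∀ {s} (v : Vec Carrier s) → 0# ·ᵥ v ≡ 0ᵥ
  ·ᵥ-zeroˡ []      = refl
  ·ᵥ-zeroˡ (x ∷ v) = cong₂ _∷_ (F.zeroˡ x) (·ᵥ-zeroˡ v)

  ·ᵥ-zeroʳ : ∀ {s} a → a ·ᵥ 0ᵥ {s} ≡ 0ᵥ
  ·ᵥ-zeroʳ {s} a = trans (map-replicate (a ⊗_) 0# s) (cong (replicate s) (F.zeroʳ a))

  ·ᵥ-inverse : ∀ {s} a (v : Vec Carrier s) → ¬ (a ≡ 0#) → (a ⁻¹) ·ᵥ (a ·ᵥ v) ≡ v
  ·ᵥ-inverse a v a≢0 = begin
    (a ⁻¹) ·ᵥ (a ·ᵥ v) ≡⟨ ·ᵥ-assoc (a ⁻¹) a v ⟨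
    ((a ⁻¹) ⊗ a) ·ᵥ v  ≡⟨ cong (_·ᵥ v) (trans (F.*-comm (a ⁻¹) a) (inverse a a≢0)) ⟩
    1# ·ᵥ v            ≡⟨ map-cong F.*-identityˡ v ⟩
    Vec.map (λ x → x) v    ≡⟨ map-id v ⟩
    v                  ∎
    where open ≡-Reasoning

  ·ᵥ-inverseʳ : ∀ {s} a (v : Vec Carrier s) → ¬ (a ≡ 0#) → a ·ᵥ ((a ⁻¹) ·ᵥ v) ≡ v
  ·ᵥ-inverseʳ a v a≢0 = begin
    a ·ᵥ ((a ⁻¹) ·ᵥ v) ≡⟨ ·ᵥ-assoc a (a ⁻¹) v ⟨
    (a ⊗ (a ⁻¹)) ·ᵥ v  ≡⟨ cong (_·ᵥ v) (inverse a a≢0) ⟩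
    1# ·ᵥ v            ≡⟨ map-cong F.*-identityˡ v ⟩
    Vec.map (λ x → x) v    ≡⟨ map-id v ⟩
    v                  ∎
    where open ≡-Reasoning

  all-zero⇒0ᵥ : ∀ {s} (v : Vec Carrier s) → VecAll.All (_≡ 0#) v → v ≡ 0ᵥ
  all-zero⇒0ᵥ []      VecAll.[]          = refl
  all-zero⇒0ᵥ (x ∷ v) (x≡0 VecAll.∷ v≡0) = cong₂ _∷_ x≡0 (all-zero⇒0ᵥ v v≡0)

module Spans (L : FiniteField) (K : Subfield L) (r : ℕ) where
  open FiniteField L using (Carrier; 0#; _⁻¹; _≟_)
  open VectorSpace L K r
  open Coordinates L
  private module Vᵣ = VecGroup r

  lincomb-0 : ∀ {m} (ws : Vec Vect m) → lincomb 0ᵥ ws ≡ zeroV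
  lincomb-0 []       = refl
  lincomb-0 (w ∷ ws) = trans (cong₂ _+ᵥ_ (·ᵥ-zeroˡ w) (lincomb-0 ws)) (Vᵣ.identityˡ zeroV)

  lincomb-+ : ∀ {m} (c d : Vec Carrier m) (ws : Vec Vect m) →
              lincomb (c +ᵥ d) ws ≡ lincomb c ws +ᵥ lincomb d ws
  lincomb-+ []      []      []       = sym (Vᵣ.identityˡ zeroV)
  lincomb-+ (a ∷ c) (b ∷ d) (w ∷ ws) =
    trans (cong₂ _+ᵥ_ (·ᵥ-distribʳ a b w) (lincomb-+ c d ws)) (Vᵣ.interchange _ _ _ _)

  lincomb-· : ∀ {m} a (c : Vec Carrier m) (ws : Vec Vect m) → lincomb (a ·ᵥ c) ws ≡ a ·ᵥ lincomb c ws
  lincomb-· a []      []       = sym (·ᵥ-zeroʳ a)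
  lincomb-· a (b ∷ c) (w ∷ ws) =
    trans (cong₂ _+ᵥ_ (·ᵥ-assoc a b w) (lincomb-· a c ws)) (sym (·ᵥ-distribˡ a _ _))

  lincomb-neg : ∀ {m} (c : Vec Carrier m) (ws : Vec Vect m) → lincomb (-ᵥ c) ws ≡ -ᵥ lincomb c ws
  lincomb-neg {m} c ws = Vᵣ.inverseˡ-unique _ _ (begin
    lincomb (-ᵥ c) ws +ᵥ lincomb c ws ≡⟨ lincomb-+ (-ᵥ c) c ws ⟨
    lincomb (-ᵥ c +ᵥ c) ws           ≡⟨ cong (λ e → lincomb e ws) (VecGroup.inverseˡ m c) ⟩
    lincomb 0ᵥ ws                    ≡⟨ lincomb-0 ws ⟩
    zeroV                            ∎)
    where open ≡-Reasoning

  module _ {m} {ws : Vec Vect m} where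

    span-+ : ∀ {x y} → InLSpan ws x → InLSpan ws y → InLSpan ws (x +ᵥ y)
    span-+ (c , refl) (d , refl) = c +ᵥ d , lincomb-+ c d ws

    span-· : ∀ a {x} → InLSpan ws x → InLSpan ws (a ·ᵥ x)
    span-· a (c , refl) = a ·ᵥ c , lincomb-· a c ws

    span-neg : ∀ {x} → InLSpan ws x → InLSpan ws (-ᵥ x)
    span-neg (c , refl) = -ᵥ c , lincomb-neg c ws

    span-shift : ∀ {t x} → InLSpan ws t → InLSpan ws (x +ᵥ t) → InLSpan ws x
    span-shift {t} {x} t∈ x+t∈ =
      subst (InLSpan ws) (Vᵣ.//-rightDividesʳ t x) (span-+ x+t∈ (span-neg t∈))

    span-unscale : ∀ {a x} → ¬ a ≡ 0# → InLSpan ws (a ·ᵥ x) → InLSpan ws x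
    span-unscale {a} {x} a≢0 ax∈ = subst (InLSpan ws) (·ᵥ-inverse a x a≢0) (span-· (a ⁻¹) ax∈)

    span-affine⁺ : ∀ {a t x} → InLSpan ws t → InLSpan ws x → InLSpan ws (a ·ᵥ x +ᵥ t)
    span-affine⁺ {a} t∈ x∈ = span-+ (span-· a x∈) t∈

    span-affine⁻ : ∀ {a t x} → ¬ a ≡ 0# → InLSpan ws t → InLSpan ws (a ·ᵥ x +ᵥ t) → InLSpan ws x
    span-affine⁻ a≢0 t∈ y∈ = span-unscale a≢0 (span-shift t∈ y∈)

  span? : ∀ {m} (ws : Vec Vect m) x → Dec (InLSpan ws x)
  span? {m} ws x = Dec.map′ satisfied (λ (c , eq) → lose (Coeffs.complete c) eq)
                     (any? (λ c → lincomb c ws ≟ᵥ x) Coeffs.list)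
    where module Coeffs = Enumeration (vecEnumeration m)

  independent⇒injective : ∀ {m} {ws : Vec Vect m} → LIndependent ws →
                          ∀ c d → lincomb c ws ≡ lincomb d ws → c ≡ d
  independent⇒injective {m} {ws} ind c d eq =
    VecGroup.x∙y⁻¹≈ε⇒x≈y m c d (all-zero⇒0ᵥ _ (ind _ (begin
      lincomb (c +ᵥ -ᵥ d) ws            ≡⟨ lincomb-+ c (-ᵥ d) ws ⟩
      lincomb c ws +ᵥ lincomb (-ᵥ d) ws ≡⟨ cong₂ _+ᵥ_ eq (lincomb-neg d ws) ⟩
      lincomb d ws +ᵥ -ᵥ lincomb d ws   ≡⟨ Vᵣ.inverseʳ _ ⟩
      zeroV                             ∎)))
    where open ≡-Reasoning

  -- ws is ordered-independent when each vector lies outside the span of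
  -- the vectors after it; this is how independent families are built up.
  OrderedIndependent : ∀ {m} → Vec Vect m → Set
  OrderedIndependent []       = ⊤
  OrderedIndependent (w ∷ ws) = ¬ InLSpan ws w × OrderedIndependent ws

  ordered⇒independent : ∀ {m} {ws : Vec Vect m} → OrderedIndependent ws → LIndependent ws
  ordered⇒independent {ws = []}     _          []       _  = VecAll.[]
  ordered⇒independent {ws = w ∷ ws} (w∉ , oi) (a ∷ cs) eq with a ≟ 0#
  ... | yes refl = refl VecAll.∷ ordered⇒independent oi cs (trans (sym drop-zero) eq)
    where
    drop-zero : 0# ·ᵥ w +ᵥ lincomb cs ws ≡ lincomb cs ws
    drop-zero = trans (cong (_+ᵥ lincomb cs ws) (·ᵥ-zeroˡ w)) (Vᵣ.identityˡ _)
  ... | no a≢0 = contradiction (span-unscale a≢0 aw∈) w∉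
    where
    aw∈ : InLSpan ws (a ·ᵥ w)
    aw∈ = subst (InLSpan ws) (sym (Vᵣ.inverseˡ-unique _ _ eq)) (span-neg (cs , refl))

module TupleSums (L : FiniteField) (K : Subfield L) (r : ℕ) where
  open FiniteField L using (Carrier; elements)
  open VectorSpace L K r
  open Coordinates L
  open Spans L K r

  ∑ᵥ : ∀ s → (Vec Carrier s → ℕ) → ℕ
  ∑ᵥ s = ∑ (vectors elements s)

  Q : ℕ
  Q = length elements

  outside? : ∀ {m} (ws : Vec Vect m) x → Dec (¬ InLSpan ws x)
  outside? ws x = ¬? (span? ws x)

  -- For independent ws of length m, x ↦ coordinates identifies ⟨ws⟩ with
  -- L^m, so sums over ⟨ws⟩ are sums over coordinate vectors.
  ∑-span : ∀ {m} {ws : Vec Vect m} → LIndependent ws → (H : Vect → ℕ) →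
           ∑ᵥ r (λ x → 𝟙 (span? ws x) * H x) ≡ ∑ᵥ m (λ c → H (lincomb c ws))
  ∑-span {m} {ws} ind = Reindexing.∑-image (vecEnumeration r) (vecEnumeration m)
    (λ c → lincomb c ws) (independent⇒injective ind _ _) (span? ws) (λ x∈ → x∈) (λ c → c , refl)

  ∑-outside+span : ∀ {m} {ws : Vec Vect m} → LIndependent ws → (H : Vect → ℕ) →
    ∑ᵥ r (λ x → 𝟙 (outside? ws x) * H x) + ∑ᵥ m (λ c → H (lincomb c ws)) ≡ ∑ᵥ r H
  ∑-outside+span {m} {ws} ind H = begin
    ∑ᵥ r (λ x → 𝟙 (outside? ws x) * H x) + ∑ᵥ m (λ c → H (lincomb c ws))
      ≡⟨ cong (∑ᵥ r (λ x → 𝟙 (outside? ws x) * H x) +_) (∑-span ind H) ⟨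
    ∑ᵥ r (λ x → 𝟙 (outside? ws x) * H x) + ∑ᵥ r (λ x → 𝟙 (span? ws x) * H x)
      ≡⟨ ∑-+ (vectors elements r) _ _ ⟨
    ∑ᵥ r (λ x → 𝟙 (outside? ws x) * H x + 𝟙 (span? ws x) * H x)
      ≡⟨ ∑-cong (vectors elements r) (λ x → trans (sym (*-distribʳ-+ (H x) (𝟙 (outside? ws x)) (𝟙 (span? ws x))))
                                               (trans (cong (_* H x) (complement x)) (*-identityˡ (H x)))) ⟩
    ∑ᵥ r H ∎
    where
    open ≡-Reasoning
    complement : ∀ x → 𝟙 (outside? ws x) + 𝟙 (span? ws x) ≡ 1
    complement x = trans (+-comm (𝟙 (outside? ws x)) _) (𝟙-compl (span? ws x))

  count-outside : ∀ {m} {ws : Vec Vect m} → LIndependent ws →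
                  ∑ᵥ r (λ x → 𝟙 (outside? ws x)) + Q ^ m ≡ Q ^ r
  count-outside {m} {ws} ind = begin
    ∑ᵥ r (λ x → 𝟙 (outside? ws x)) + Q ^ m
      ≡⟨ cong₂ _+_ (∑-cong (vectors elements r) (λ x → sym (*-identityʳ _))) (sym (count-vectors elements m)) ⟩
    ∑ᵥ r (λ x → 𝟙 (outside? ws x) * 1) + ∑ᵥ m (λ _ → 1)
      ≡⟨ ∑-outside+span ind (λ _ → 1) ⟩
    ∑ᵥ r (λ _ → 1)
      ≡⟨ count-vectors elements r ⟩
    Q ^ r ∎
    where open ≡-Reasoning

  -- ∑ᵢ m F : the sum of F over all ordered-independent m-tuples, built by
  -- prepending to a tuple ws a vector outside ⟨ws⟩.
  ∑ᵢ : ∀ m → (Vec Vect m → ℕ) → ℕ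
  ∑ᵢ zero    F = F []
  ∑ᵢ (suc m) F = ∑ᵢ m (λ ws → ∑ᵥ r (λ w → 𝟙 (outside? ws w) * F (w ∷ ws)))

  ∑ᵢ-cong : ∀ m {F G : Vec Vect m → ℕ} →
            (∀ ws → OrderedIndependent ws → F ws ≡ G ws) → ∑ᵢ m F ≡ ∑ᵢ m G
  ∑ᵢ-cong zero    F≡G = F≡G [] tt
  ∑ᵢ-cong (suc m) {F} {G} F≡G = ∑ᵢ-cong m (λ ws oi → ∑-cong (vectors elements r) (extend ws oi))
    where
    extend : ∀ ws → OrderedIndependent ws → ∀ w →
             𝟙 (outside? ws w) * F (w ∷ ws) ≡ 𝟙 (outside? ws w) * G (w ∷ ws)
    extend ws oi w with outside? ws w
    ... | yes w∉ = cong (1 *_) (F≡G (w ∷ ws) (w∉ , oi))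
    ... | no  _  = refl

  ∑ᵢ-mono : ∀ m {F G : Vec Vect m → ℕ} →
            (∀ ws → OrderedIndependent ws → F ws ≤ G ws) → ∑ᵢ m F ≤ ∑ᵢ m G
  ∑ᵢ-mono zero    F≤G = F≤G [] tt
  ∑ᵢ-mono (suc m) {F} {G} F≤G = ∑ᵢ-mono m (λ ws oi → ∑-mono (vectors elements r) (extend ws oi))
    where
    extend : ∀ ws → OrderedIndependent ws → ∀ w →
             𝟙 (outside? ws w) * F (w ∷ ws) ≤ 𝟙 (outside? ws w) * G (w ∷ ws)
    extend ws oi w with outside? ws w
    ... | yes w∉ = *-monoʳ-≤ 1 (F≤G (w ∷ ws) (w∉ , oi))
    ... | no  _  = z≤n

  ∑ᵢ-+ : ∀ m (F G : Vec Vect m → ℕ) → ∑ᵢ m (λ ws → F ws + G ws) ≡ ∑ᵢ m F + ∑ᵢ m G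
  ∑ᵢ-+ zero    F G = refl
  ∑ᵢ-+ (suc m) F G = trans (∑ᵢ-cong m split) (∑ᵢ-+ m _ _)
    where
    split : ∀ ws → OrderedIndependent ws →
            ∑ᵥ r (λ w → 𝟙 (outside? ws w) * (F (w ∷ ws) + G (w ∷ ws))) ≡
            ∑ᵥ r (λ w → 𝟙 (outside? ws w) * F (w ∷ ws)) + ∑ᵥ r (λ w → 𝟙 (outside? ws w) * G (w ∷ ws))
    split ws _ = trans (∑-cong (vectors elements r) (λ w → *-distribˡ-+ (𝟙 (outside? ws w)) _ _))
                       (∑-+ (vectors elements r) _ _)

  ∑ᵢ-*ˡ : ∀ m a (F : Vec Vect m → ℕ) → ∑ᵢ m (λ ws → a * F ws) ≡ a * ∑ᵢ m F
  ∑ᵢ-*ˡ zero    a F = refl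
  ∑ᵢ-*ˡ (suc m) a F = trans (∑ᵢ-cong m pull) (∑ᵢ-*ˡ m a _)
    where
    pull : ∀ ws → OrderedIndependent ws →
           ∑ᵥ r (λ w → 𝟙 (outside? ws w) * (a * F (w ∷ ws))) ≡ a * ∑ᵥ r (λ w → 𝟙 (outside? ws w) * F (w ∷ ws))
    pull ws _ = trans (∑-cong (vectors elements r) (λ w → x∙yz≈y∙xz (𝟙 (outside? ws w)) a _))
                      (∑-*ˡ (vectors elements r) a _)

  ∑ᵢ-const : ∀ m c → ∑ᵢ m (λ _ → c) ≡ c * ∑ᵢ m (λ _ → 1)
  ∑ᵢ-const m c = trans (∑ᵢ-cong m (λ _ _ → sym (*-identityʳ c))) (∑ᵢ-*ˡ m c (λ _ → 1))

module Averaging (L : FiniteField) (K : Subfield L) (r : ℕ)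
                 (U : Pred (VectorSpace.Vect L K r) 0ℓ) (U? : Decidable U) where
  open FiniteField L using (Carrier; elements; 0#; _⁻¹; _≟_)
  open VectorSpace L K r
  open Coordinates L
  open Spans L K r
  open TupleSums L K r
  private module Vᵣ = VecGroup r

  sizeU : ℕ
  sizeU = ∑ᵥ r (λ x → 𝟙 (U? x))

  -- |U ∩ ⟨ws⟩| for independent ws, counted through coordinates
  inside : ∀ {m} → Vec Vect m → ℕ
  inside {m} ws = ∑ᵥ m (λ c → 𝟙 (U? (lincomb c ws)))

  outsideU outsideV : ∀ {m} → Vec Vect m → ℕ
  outsideU ws = ∑ᵥ r (λ x → 𝟙 (outside? ws x) * 𝟙 (U? x))
  outsideV ws = ∑ᵥ r (λ x → 𝟙 (outside? ws x))

  nonzero : ℕ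
  nonzero = ∑ elements (λ a → 𝟙 (¬? (a ≟ 0#)))

  nonzero+1 : suc nonzero ≡ Q
  nonzero+1 = begin
    suc nonzero                                   ≡⟨ cong suc (∑-cong elements (λ a → sym (*-identityʳ _))) ⟩
    1 + ∑ elements (λ a → 𝟙 (¬? (a ≟ 0#)) * 1)   ≡⟨ Summation.∑-split fieldEnumeration 0# (λ _ → 1) ⟨
    ∑ elements (λ _ → 1)                          ≡⟨ ∑-length elements ⟩
    Q                                             ∎
    where open ≡-Reasoning

  split-U : ∀ {m} {ws : Vec Vect m} → LIndependent ws → outsideU ws + inside ws ≡ sizeU
  split-U ind = ∑-outside+span ind (λ x → 𝟙 (U? x))

  -- For a ≢ 0 and t ∈ ⟨ws⟩, the affine bijection w ↦ a·w + t of L^r maps the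
  -- complement of ⟨ws⟩ onto itself, so it does not change |U ∖ ⟨ws⟩|.
  affine-invariance : ∀ {m} (ws : Vec Vect m) {a} → ¬ a ≡ 0# → ∀ c →
    ∑ᵥ r (λ w → 𝟙 (outside? ws w) * 𝟙 (U? (a ·ᵥ w +ᵥ lincomb c ws))) ≡ outsideU ws
  affine-invariance ws {a} a≢0 c = begin
    ∑ᵥ r (λ w → 𝟙 (outside? ws w) * 𝟙 (U? (g w)))
      ≡⟨ ∑-cong (vectors elements r) (λ w → cong (_* 𝟙 (U? (g w))) (preserves-outside w)) ⟩
    ∑ᵥ r (λ w → 𝟙 (outside? ws (g w)) * 𝟙 (U? (g w)))
      ≡⟨ ∑-bijection (vecEnumeration r) g h h∘g g∘h (λ x → 𝟙 (outside? ws x) * 𝟙 (U? x)) ⟩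
    outsideU ws ∎
    where
    open ≡-Reasoning
    t = lincomb c ws
    t∈ : InLSpan ws t
    t∈ = c , refl
    g h : Vect → Vect
    g w = a ·ᵥ w +ᵥ t
    h y = (a ⁻¹) ·ᵥ (y +ᵥ -ᵥ t)
    h∘g : ∀ w → h (g w) ≡ w
    h∘g w = trans (cong ((a ⁻¹) ·ᵥ_) (Vᵣ.//-rightDividesʳ t (a ·ᵥ w))) (·ᵥ-inverse a w a≢0)
    g∘h : ∀ y → g (h y) ≡ y
    g∘h y = trans (cong (_+ᵥ t) (·ᵥ-inverseʳ a _ a≢0)) (Vᵣ.//-rightDividesˡ t y)
    preserves-outside : ∀ w → 𝟙 (outside? ws w) ≡ 𝟙 (outside? ws (g w))
    preserves-outside w = 𝟙-cong (outside? ws w) (outside? ws (g w))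
      (λ w∉ gw∈ → w∉ (span-affine⁻ a≢0 t∈ gw∈)) (λ gw∉ w∈ → gw∉ (span-affine⁺ t∈ w∈))

  -- The vectors of ⟨w, ws⟩ are the a·w + t with a ∈ L and t ∈ ⟨ws⟩.
  inside-∷ : ∀ {m} w (ws : Vec Vect m) →
    inside (w ∷ ws) ≡ ∑ elements (λ a → ∑ᵥ m (λ c → 𝟙 (U? (a ·ᵥ w +ᵥ lincomb c ws))))
  inside-∷ {m} w ws = ∑-cartesianProductWith _∷_ elements (vectors elements m) _

  -- For a fixed scalar a, the number of pairs (w ∉ ⟨ws⟩, t ∈ ⟨ws⟩) with
  -- a·w + t ∈ U (t counted through its coordinates c).
  affineCount : ∀ {m} → Vec Vect m → Carrier → ℕ
  affineCount {m} ws a =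
    ∑ᵥ m (λ c → ∑ᵥ r (λ w → 𝟙 (outside? ws w) * 𝟙 (U? (a ·ᵥ w +ᵥ lincomb c ws))))

  -- For a = 0 the condition is t ∈ U, independently of w.
  affineCount-zero : ∀ {m} (ws : Vec Vect m) → affineCount ws 0# ≡ outsideV ws * inside ws
  affineCount-zero {m} ws = begin
    affineCount ws 0#
      ≡⟨ ∑-cong (vectors elements m) (λ c → ∑-cong (vectors elements r) (λ w →
           cong (λ y → 𝟙 (outside? ws w) * 𝟙 (U? y))
                (trans (cong (_+ᵥ lincomb c ws) (·ᵥ-zeroˡ w)) (Vᵣ.identityˡ _)))) ⟩
    ∑ᵥ m (λ c → ∑ᵥ r (λ w → 𝟙 (outside? ws w) * 𝟙 (U? (lincomb c ws))))
      ≡⟨ ∑-cong (vectors elements m) (λ c → ∑-*ʳ (vectors elements r) _ _) ⟩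
    ∑ᵥ m (λ c → outsideV ws * 𝟙 (U? (lincomb c ws)))
      ≡⟨ ∑-*ˡ (vectors elements m) (outsideV ws) _ ⟩
    outsideV ws * inside ws ∎
    where open ≡-Reasoning

  -- For a ≢ 0, each of the Q^m vectors t contributes |U ∖ ⟨ws⟩|.
  affineCount-nonzero : ∀ {m} (ws : Vec Vect m) {a} → ¬ a ≡ 0# → affineCount ws a ≡ Q ^ m * outsideU ws
  affineCount-nonzero {m} ws a≢0 = begin
    affineCount ws _              ≡⟨ ∑-cong (vectors elements m) (affine-invariance ws a≢0) ⟩
    ∑ᵥ m (λ _ → outsideU ws)      ≡⟨ ∑-cong (vectors elements m) (λ _ → sym (*-identityˡ _)) ⟩
    ∑ᵥ m (λ _ → 1 * outsideU ws)  ≡⟨ ∑-*ʳ (vectors elements m) (λ _ → 1) (outsideU ws) ⟩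
    ∑ᵥ m (λ _ → 1) * outsideU ws  ≡⟨ cong (_* outsideU ws) (count-vectors elements m) ⟩
    Q ^ m * outsideU ws           ∎
    where open ≡-Reasoning

  -- Counting |U ∩ ⟨w, ws⟩| over all w ∉ ⟨ws⟩, by splitting according to the
  -- coefficient a of w.
  ∑-outside-inside : ∀ {m} (ws : Vec Vect m) →
    ∑ᵥ r (λ w → 𝟙 (outside? ws w) * inside (w ∷ ws)) ≡
    outsideV ws * inside ws + nonzero * (Q ^ m * outsideU ws)
  ∑-outside-inside {m} ws = begin
    ∑ᵥ r (λ w → 𝟙 (outside? ws w) * inside (w ∷ ws))
      ≡⟨ ∑-cong (vectors elements r) expand ⟩
    ∑ᵥ r (λ w → ∑ elements (λ a → ∑ᵥ m (λ c → X a c w)))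
      ≡⟨ ∑-swap (vectors elements r) elements _ ⟩
    ∑ elements (λ a → ∑ᵥ r (λ w → ∑ᵥ m (λ c → X a c w)))
      ≡⟨ ∑-cong elements (λ a → ∑-swap (vectors elements r) (vectors elements m) _) ⟩
    ∑ elements (affineCount ws)
      ≡⟨ Summation.∑-split fieldEnumeration 0# (affineCount ws) ⟩
    affineCount ws 0# + ∑ elements (λ a → 𝟙 (¬? (a ≟ 0#)) * affineCount ws a)
      ≡⟨ cong₂ _+_ (affineCount-zero ws) (∑-cong elements nonzero-terms) ⟩
    outsideV ws * inside ws + ∑ elements (λ a → 𝟙 (¬? (a ≟ 0#)) * (Q ^ m * outsideU ws))
      ≡⟨ cong (outsideV ws * inside ws +_) (∑-*ʳ elements _ (Q ^ m * outsideU ws)) ⟩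
    outsideV ws * inside ws + nonzero * (Q ^ m * outsideU ws) ∎
    where
    open ≡-Reasoning
    X : Carrier → Vec Carrier m → Vect → ℕ
    X a c w = 𝟙 (outside? ws w) * 𝟙 (U? (a ·ᵥ w +ᵥ lincomb c ws))
    expand : ∀ w → 𝟙 (outside? ws w) * inside (w ∷ ws) ≡ ∑ elements (λ a → ∑ᵥ m (λ c → X a c w))
    expand w = trans (cong (𝟙 (outside? ws w) *_) (inside-∷ w ws))
      (trans (sym (∑-*ˡ elements (𝟙 (outside? ws w)) _))
             (∑-cong elements (λ a → sym (∑-*ˡ (vectors elements m) (𝟙 (outside? ws w)) _))))
    nonzero-terms : ∀ a → 𝟙 (¬? (a ≟ 0#)) * affineCount ws a ≡ 𝟙 (¬? (a ≟ 0#)) * (Q ^ m * outsideU ws)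
    nonzero-terms a with a ≟ 0#
    ... | yes _  = refl
    ... | no a≢0 = cong (1 *_) (affineCount-nonzero ws a≢0)

∸-split : ∀ {n p} → 1 ≤ p → p ≤ n → (n ∸ p) + (p ∸ 1) ≡ n ∸ 1
∸-split {n} {p} 1≤p p≤n = trans (sym (+-∸-assoc (n ∸ p) 1≤p)) (cong (_∸ 1) (m∸n+n≡m p≤n))

*-suc-∸1 : ∀ a {p} → 1 ≤ p → a * p + (p ∸ 1) ≡ suc a * p ∸ 1
*-suc-∸1 a {p} 1≤p = trans (sym (+-∸-assoc (a * p) 1≤p)) (cong (_∸ 1) (+-comm (a * p) p))

-- Think of G tuples, of total
-- "inside" count D and total "outside" count S = (u + 1)·G − D; if the
-- average inside count is (u·E + N')/N', then extending each tuple in A ways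
-- (with A + E = N'), where the new inside count is A·D + c·P·S, keeps the
-- average of the same form with E replaced by c·P + E.
mean-step : ∀ {u N' A E P c G D S} → A + E ≡ N' →
            D * N' ≡ G * (u * E + N') → S + D ≡ suc u * G →
            (A * D + c * (P * S)) * N' ≡ A * G * (u * (c * P + E) + N')
mean-step {u} {N'} {A} {E} {P} {c} {G} {D} {S} A+E≡N' mean S+D≡ = begin
  (A * D + c * (P * S)) * N'       ≡⟨ distribute A D c P S N' ⟩
  A * (D * N') + c * P * (S * N')  ≡⟨ cong₂ (λ x y → A * x + c * P * y) mean outside-mean ⟩
  A * (G * (u * E + N')) + c * P * (G * u * A) ≡⟨ collect A G u E N' c P ⟩
  A * G * (u * (c * P + E) + N')   ∎
  where
  open ≡-Reasoning
  distribute : ∀ A D c P S N' → (A * D + c * (P * S)) * N' ≡ A * (D * N') + c * P * (S * N')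
  distribute = solve-∀
  collect : ∀ A G u E N' c P → A * (G * (u * E + N')) + c * P * (G * u * A) ≡ A * G * (u * (c * P + E) + N')
  collect = solve-∀
  expand : ∀ u G A E → suc u * G * (A + E) ≡ G * u * A + G * (u * E + (A + E))
  expand = solve-∀
  outside-mean : S * N' ≡ G * u * A
  outside-mean = +-cancelʳ-≡ _ _ _ (begin
    S * N' + G * (u * E + N')           ≡⟨ cong (S * N' +_) mean ⟨
    S * N' + D * N'                     ≡⟨ *-distribʳ-+ N' S D ⟨
    (S + D) * N'                        ≡⟨ cong₂ _*_ S+D≡ (sym A+E≡N') ⟩
    suc u * G * (A + E)                 ≡⟨ expand u G A E ⟩
    G * u * A + G * (u * E + (A + E))   ≡⟨ cong (λ y → G * u * A + G * (u * E + y)) A+E≡N' ⟩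
    G * u * A + G * (u * E + N')        ∎)

mean-bound : ∀ {G D N' x c} → 0 < G → D * N' ≡ G * (x + N') → D ≤ c * G → x ≤ (c ∸ 1) * N'
mean-bound {G} {D} {N'} {x} {c} 0<G mean D≤cG = begin
  x                ≤⟨ m+n≤o⇒m≤o∸n x (*-cancelˡ-≤ G {{>-nonZero 0<G}} scaled) ⟩
  c * N' ∸ N'      ≡⟨ cong (c * N' ∸_) (*-identityˡ N') ⟨
  c * N' ∸ 1 * N'  ≡⟨ *-distribʳ-∸ N' c 1 ⟨
  (c ∸ 1) * N'     ∎
  where
  open ≤-Reasoning
  scaled : G * (x + N') ≤ G * (c * N')
  scaled = begin
    G * (x + N')  ≡⟨ mean ⟨
    D * N'        ≤⟨ *-monoˡ-≤ N' D≤cG ⟩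
    c * G * N'    ≡⟨ cong (_* N') (*-comm c G) ⟩
    G * c * N'    ≡⟨ *-assoc G c N' ⟩
    G * (c * N')  ∎

module MeanValue (L : FiniteField) (K : Subfield L) (r : ℕ)
                 (U : Pred (VectorSpace.Vect L K r) 0ℓ) (U? : Decidable U) where
  open FiniteField L using (elements; complete; 0#; 1#; 0≢1; _≟_)
  open Subfield K using (mem?)
  open VectorSpace L K r
  open Coordinates L
  open Spans L K r
  open TupleSums L K r
  open Averaging L K r U U?

  tuples insideTotal outsideTotal : ℕ → ℕ
  tuples       m = ∑ᵢ m (λ _ → 1)
  insideTotal  m = ∑ᵢ m inside
  outsideTotal m = ∑ᵢ m outsideU

  outsideV-size : ∀ {m} {ws : Vec Vect m} → OrderedIndependent ws → outsideV ws ≡ Q ^ r ∸ Q ^ m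
  outsideV-size {m} oi =
    trans (sym (m+n∸n≡m _ (Q ^ m))) (cong (_∸ Q ^ m) (count-outside (ordered⇒independent oi)))

  tuples-suc : ∀ m → tuples (suc m) ≡ (Q ^ r ∸ Q ^ m) * tuples m
  tuples-suc m = trans (∑ᵢ-cong m (λ ws oi → trans (∑-cong (vectors elements r) (λ w → *-identityʳ _))
                                                  (outsideV-size oi)))
                       (∑ᵢ-const m _)

  insideTotal-suc : ∀ m → insideTotal (suc m) ≡
    (Q ^ r ∸ Q ^ m) * insideTotal m + nonzero * (Q ^ m * outsideTotal m)
  insideTotal-suc m = begin
    insideTotal (suc m)
      ≡⟨ ∑ᵢ-cong m (λ ws oi → trans (∑-outside-inside ws)
                                     (cong (λ A → A * inside ws + nonzero * (Q ^ m * outsideU ws))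
                                           (outsideV-size oi))) ⟩
    ∑ᵢ m (λ ws → (Q ^ r ∸ Q ^ m) * inside ws + nonzero * (Q ^ m * outsideU ws))
      ≡⟨ ∑ᵢ-+ m _ _ ⟩
    ∑ᵢ m (λ ws → (Q ^ r ∸ Q ^ m) * inside ws) + ∑ᵢ m (λ ws → nonzero * (Q ^ m * outsideU ws))
      ≡⟨ cong₂ _+_ (∑ᵢ-*ˡ m (Q ^ r ∸ Q ^ m) inside)
                   (trans (∑ᵢ-*ˡ m nonzero _) (cong (nonzero *_) (∑ᵢ-*ˡ m (Q ^ m) outsideU))) ⟩
    (Q ^ r ∸ Q ^ m) * insideTotal m + nonzero * (Q ^ m * outsideTotal m) ∎
    where open ≡-Reasoning

  outside+inside : ∀ m → outsideTotal m + insideTotal m ≡ sizeU * tuples m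
  outside+inside m = trans (sym (∑ᵢ-+ m outsideU inside))
    (trans (∑ᵢ-cong m (λ ws oi → split-U (ordered⇒independent oi))) (∑ᵢ-const m sizeU))

  -- Q ≥ 2, so its powers are positive and strictly increasing
  1≤Qᵐ : ∀ m → 1 ≤ Q ^ m
  1≤Qᵐ m = subst (λ z → 1 ≤ z ^ m) nonzero+1 (m^n>0 (suc nonzero) m)

  Qᵐ≤Qᵐ⁺¹ : ∀ m → Q ^ m ≤ Q ^ suc m
  Qᵐ≤Qᵐ⁺¹ m = subst (λ z → Q ^ m ≤ z * Q ^ m) nonzero+1 (m≤m+n (Q ^ m) _)

  1<Q : 1 < Q
  1<Q = subst (1 <_) nonzero+1 (s≤s (≤-trans (≤-reflexive (sym (𝟙-yes (¬? (1# ≟ 0#)) (≢-sym 0≢1))))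
                                              (∑-≥ (λ a → 𝟙 (¬? (a ≟ 0#))) (complete 1#))))

  mean-inside : U zeroV → ∀ m → Q ^ m ≤ Q ^ r →
    insideTotal m * (Q ^ r ∸ 1) ≡ tuples m * ((sizeU ∸ 1) * (Q ^ m ∸ 1) + (Q ^ r ∸ 1))
  mean-inside 0∈U zero _ =
    trans (cong (λ z → (z + 0) * (Q ^ r ∸ 1)) (𝟙-yes (U? zeroV) 0∈U))
          (cong (λ z → z + (Q ^ r ∸ 1) + 0) (sym (*-zeroʳ (sizeU ∸ 1))))
  mean-inside 0∈U (suc m) Qᵐ⁺¹≤Qʳ = begin
    insideTotal (suc m) * (Q ^ r ∸ 1)
      ≡⟨ cong (_* (Q ^ r ∸ 1)) (insideTotal-suc m) ⟩
    ((Q ^ r ∸ Q ^ m) * insideTotal m + nonzero * (Q ^ m * outsideTotal m)) * (Q ^ r ∸ 1)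
      ≡⟨ mean-step {u = sizeU ∸ 1} {A = Q ^ r ∸ Q ^ m} {E = Q ^ m ∸ 1} {P = Q ^ m} {c = nonzero}
                   {G = tuples m} {D = insideTotal m} {S = outsideTotal m}
                   (∸-split (1≤Qᵐ m) Qᵐ≤Qʳ) (mean-inside 0∈U m Qᵐ≤Qʳ)
                   (trans (outside+inside m) (cong (_* tuples m) (sym 1+[|U|-1]))) ⟩
    (Q ^ r ∸ Q ^ m) * tuples m * ((sizeU ∸ 1) * (nonzero * Q ^ m + (Q ^ m ∸ 1)) + (Q ^ r ∸ 1))
      ≡⟨ cong₂ (λ x y → x * ((sizeU ∸ 1) * y + (Q ^ r ∸ 1))) (sym (tuples-suc m)) Qᵐ⁺¹-1 ⟩
    tuples (suc m) * ((sizeU ∸ 1) * (Q ^ suc m ∸ 1) + (Q ^ r ∸ 1)) ∎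
    where
    open ≡-Reasoning
    Qᵐ≤Qʳ : Q ^ m ≤ Q ^ r
    Qᵐ≤Qʳ = ≤-trans (Qᵐ≤Qᵐ⁺¹ m) Qᵐ⁺¹≤Qʳ
    1+[|U|-1] : suc (sizeU ∸ 1) ≡ sizeU
    1+[|U|-1] = suc-pred sizeU {{>-nonZero (≤-trans (≤-reflexive (sym (𝟙-yes (U? zeroV) 0∈U)))
                                                     (∑-≥ (λ x → 𝟙 (U? x)) (Enumeration.complete (vecEnumeration r) zeroV)))}}
    Qᵐ⁺¹-1 : nonzero * Q ^ m + (Q ^ m ∸ 1) ≡ Q ^ suc m ∸ 1
    Qᵐ⁺¹-1 = trans (*-suc-∸1 nonzero (1≤Qᵐ m)) (cong (λ z → z * Q ^ m ∸ 1) nonzero+1)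

  tuples-pos : ∀ {h} → Q ^ h ≤ Q ^ r → ∀ m → m ≤ h → 0 < tuples m
  tuples-pos Qʰ≤Qʳ zero    _     = s≤s z≤n
  tuples-pos Qʰ≤Qʳ (suc m) 1+m≤h = subst (0 <_) (sym (tuples-suc m))
    (*-mono-≤ (m<n⇒0<n∸m (<-≤-trans (^-monoʳ-< Q 1<Q 1+m≤h) Qʰ≤Qʳ))
              (tuples-pos Qʰ≤Qʳ m (≤-trans (n≤1+n m) 1+m≤h)))

  inside-bound : ∀ {m k} {ws : Vec Vect m} → LIndependent ws →
                 KDimAtMost (λ x → U x × InLSpan ws x) k → inside ws ≤ Subfield.order K ^ k
  inside-bound {m} {k} {ws} ind (bs , _ , in-K-span) = begin
    inside ws
      ≡⟨ ∑-span ind (λ x → 𝟙 (U? x)) ⟨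
    ∑ᵥ r (λ x → 𝟙 (span? ws x) * 𝟙 (U? x))
      ≡⟨ ∑-cong (vectors elements r) (λ x → trans (*-comm (𝟙 (span? ws x)) (𝟙 (U? x)))
                                                    (sym (𝟙-× (U? x) (span? ws x)))) ⟩
    ∑ᵥ r (λ x → 𝟙 (U? x ×-dec span? ws x))
      ≤⟨ Reindexing.count-cover (vecEnumeration r) (vecEnumeration k) (λ d → lincomb d bs)
           (λ x → U? x ×-dec span? ws x) (VecAll.all? mem?) in-K-span ⟩
    ∑ᵥ k (λ d → 𝟙 (VecAll.all? mem? d))
      ≡⟨ count-vectors-All elements mem? k ⟩
    ∑ elements (λ a → 𝟙 (mem? a)) ^ k
      ≡⟨ cong (_^ k) (length-filter mem? elements) ⟨
    Subfield.order K ^ k ∎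
    where open ≤-Reasoning

  evasive-bound : ∀ {h k} → U zeroV → IsEvasive U h k →
                  (sizeU ∸ 1) * (Q ^ h ∸ 1) ≤ (Subfield.order K ^ k ∸ 1) * (Q ^ r ∸ 1)
  evasive-bound {h} {k} 0∈U ((us , _ , us-ind) , evasive) =
    mean-bound {c = Subfield.order K ^ k} (tuples-pos Qʰ≤Qʳ h ≤-refl) (mean-inside 0∈U h Qʰ≤Qʳ) insideTotal≤
    where
    Qʰ≤Qʳ : Q ^ h ≤ Q ^ r
    Qʰ≤Qʳ = ≤-trans (m≤n+m (Q ^ h) _) (≤-reflexive (count-outside us-ind))
    insideTotal≤ : insideTotal h ≤ Subfield.order K ^ k * tuples h
    insideTotal≤ = ≤-trans
      (∑ᵢ-mono h (λ ws oi → inside-bound (ordered⇒independent oi) (evasive ws (ordered⇒independent oi))))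
      (≤-reflexive (∑ᵢ-const h _))

-- The enumeration of L^s used to define the cardinality in the statement is
-- the one used throughout.
allVecs≡vectors : ∀ L K r s → VectorSpace.allVecs L K r s ≡ vectors (FiniteField.elements L) s
allVecs≡vectors L K r zero    = refl
allVecs≡vectors L K r (suc s) =
  trans (cong (λ vs → concatMap (λ x → map (x ∷_) vs) (FiniteField.elements L)) (allVecs≡vectors L K r s))
        (concatMap-map≡cartesianProductWith _∷_ (FiniteField.elements L) _)

theorem4p3 : (q n r h k : ℕ) (L : FiniteField) (K : Subfield L) →
    0 < h → 0 < k →
    Subfield.order K ≡ q → FiniteField.order L ≡ q ^ n →
    (U : Pred (VectorSpace.Vect L K r) 0ℓ) (U? : Decidable U) →
    VectorSpace.IsKSubspace L K r U →
    VectorSpace.IsEvasive L K r U h k →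
    (VectorSpace.card L K r U? ∸ 1) * (q ^ (h * n) ∸ 1)
    ≤ (q ^ k ∸ 1) * (q ^ (r * n) ∸ 1)
theorem4p3 q n r h k L K _ _ |K|≡q |L|≡qⁿ U U? U-subspace U-evasive =
  subst₂ _≤_ (cong₂ _*_ (cong (_∸ 1) |U|≡card) (cong (_∸ 1) (Qᵐ≡ h)))
             (cong₂ _*_ (cong (λ z → z ^ k ∸ 1) |K|≡q) (cong (_∸ 1) (Qᵐ≡ r)))
             (MeanValue.evasive-bound L K r U U? (VectorSpace.IsKSubspace.has0 U-subspace) U-evasive)
  where
  open FiniteField L using (elements)
  Qᵐ≡ : ∀ m → length elements ^ m ≡ q ^ (m * n)
  Qᵐ≡ m = trans (cong (_^ m) |L|≡qⁿ) (trans (^-*-assoc q n m) (cong (q ^_) (*-comm n m)))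
  |U|≡card : Averaging.sizeU L K r U U? ≡ VectorSpace.card L K r U?
  |U|≡card = sym (trans (cong (λ vs → length (filter U? vs)) (allVecs≡vectors L K r r))
                        (length-filter U? (vectors elements r)))
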